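{- Let $0\le a\le b$ and let $m$ be a mask. Consider the monitoring context $\mathcal C([\cdot])=\mathbf F_{[a,b]}[\cdot]$ (i.e. $\mathcal C(s)=\mathbf F_{[a,b]}s$) or the monitoring context $\mathcal C([\cdot])=\mathbf G_{[a,b]}[\cdot]$ (i.e. $\mathcal C(s)=\mathbf G_{[a,b]}s$). In each case the past mask $\mathbf P_{[a,b]}m$ is sufficient for $\mathcal C([\cdot])$ under $m$ and optimal for $\mathcal C([\cdot])$ under $m$.
   Context: A three-valued signal is a function $s:[0,\infty)\to\{\mathbf T,\mathbf F,\mathbf U\}$ that is constant on each of finitely many intervals covering its domain (intervals may be degenerate). Logic is Kleene's three-valued logic. For a signal $s$ and $0\le a\le b$, $(\mathbf F_{[a,b]}s)(t)=\mathbf T$ if $s(t')=\mathbf T$ for some $t'\in t+[a,b]$, $=\mathbf F$ if $s(t')=\mathbf F$ for all $t'\in t+[a,b]$, and $=\mathbf U$ otherwise; dually $\mathbf G_{[a,b]}s=\neg\mathbf F_{[a,b]}\neg s$, where $\neg$ swaps $\mathbf T,\mathbf F$ and fixes $\mathbf U$. A mask is a finite sequence $m=(I_j)_j$ of pairwise disjoint intervals in $[0,\infty)$, identified with the boolean signal $m(t)=\mathbf T$ iff $t\in\bigcup_j I_j$. The past mask is $\mathbf P_{[a,b]}m=(I_j+[a,b])_j$, where $I+[a,b]=\{x+y: x\in I, y\in[a,b]\}$ (as a boolean signal: true at $t$ iff $t\in\bigcup_j(I_j+[a,b])$). For a signal $s$ and mask $m$, $s|_m(t)=s(t)$ if $m(t)=\mathbf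 T$ and $\mathbf U$ otherwise. A mask $m'$ is sufficient for a context $\mathcal C([\cdot])$ under a mask $n$ if for every three-valued signal $s$, $\mathcal C(s)|_n=\mathcal C(s|_{m'})|_n$; it is optimal if it is sufficient and is pointwise $\le$ every sufficient mask (with $\mathbf F<\mathbf T$). -}

module Defs where

open import Data.Bool using (Bool; true; false)
open import Data.Maybe using (Maybe; just; nothing)
open import Data.List using (List)
open import Data.List.Relation.Unary.Any using (Any)
open import Data.List.Relation.Unary.All using (All)
open import Data.List.Relation.Unary.AllPairs using (AllPairs)
open import Data.Product using (Σ; ∃; _×_; _,_)
open import Data.Sum using (_⊎_)
open import Data.Unit using (⊤)
open import Data.Empty using (⊥)
open import Relation.Nullary using (¬_)
open import Relation.Binary.PropositionalEquality using (_≡_)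
open import Relation.Binary.Structures using (IsTotalOrder)
open import Algebra.Structures using (IsCommutativeRing)
open import Function.Bundles using (_⇔_)

-- The real line, axiomatised as a (Dedekind-)complete ordered field.
-- (agda-stdlib has no real numbers; any two such structures are
-- isomorphic, so quantifying over all of them is the same as fixing ℝ.)

record RealField : Set₁ where
  infixl 6 _+_
  infixl 7 _*_
  infix  4 _≤_
  field
    R    : Set
    _+_  : R → R → R
    _*_  : R → R → R
    -_   : R → R
    0#   : R
    1#   : R
    _≤_  : R → R → Set
    isCommutativeRing : IsCommutativeRing _≡_ _+_ _*_ -_ 0# 1#
    0≢1  : ¬ (0# ≡ 1#)
    inverse : ∀ x → ¬ (x ≡ 0#) → ∃ λ y → x * y ≡ 1#
    isTotalOrder : IsTotalOrder _≡_ _≤_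
    +-mono-≤ : ∀ x y z → x ≤ y → x + z ≤ y + z
    *-nonneg : ∀ x y → 0# ≤ x → 0# ≤ y → 0# ≤ x * y
    complete : (A : R → Set) → (∃ λ x → A x) → (∃ λ u → ∀ x → A x → x ≤ u) →
               ∃ λ s → (∀ x → A x → x ≤ s) × (∀ u → (∀ x → A x → x ≤ u) → s ≤ u)

data V3 : Set where
  T F U : V3

neg : V3 → V3
neg T = F
neg F = T
neg U = U

module Semantics (ℝ : RealField) where
  open RealField ℝ

  _<_ : R → R → Set
  x < y = x ≤ y × ¬ (x ≡ y)

  -- An interval of the real line: lower endpoint (open/closed) and an
  -- upper endpoint which is either a real (open/closed) or +∞ (nothing).
  record Interval : Set where
    constructor interval
    field
      lo       : R
      loClosed : Bool
      hi       : Maybe R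
      hiClosed : Bool

  LowerOK : Bool → R → R → Set
  LowerOK true  l t = l ≤ t
  LowerOK false l t = l < t

  UpperOK : Bool → Maybe R → R → Set
  UpperOK _     nothing  t = ⊤
  UpperOK true  (just h) t = t ≤ h
  UpperOK false (just h) t = t < h

  _∈ᴵ_ : R → Interval → Set
  t ∈ᴵ interval l lc h hc = LowerOK lc l t × UpperOK hc h t

  InWindow : R → R → R → R → Set
  InWindow a b t t' = ∃ λ y → a ≤ y × y ≤ b × t' ≡ t + y

  -- Three-valued signals s : [0,∞) → {T,F,U}, piecewise constant on
  -- finitely many intervals covering [0,∞).  (Values at negative
  -- arguments are irrelevant.)

  Signal : Set
  Signal = R → V3

  PiecewiseConstant : Signal → Set
  PiecewiseConstant s =
    Σ (List Interval) λ Is →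
      (∀ t → 0# ≤ t → Any (t ∈ᴵ_) Is) ×
      All (λ I → ∀ t t' → t ∈ᴵ I → t' ∈ᴵ I → s t ≡ s t') Is

  -- Semantic objects are handled relationally: "S t v" means the value of
  -- the (generalised) signal S at time t is v.
  SigRel : Set₁
  SigRel = R → V3 → Set

  ⟦_⟧ : Signal → SigRel
  ⟦ s ⟧ t v = s t ≡ v

  FHas : R → R → SigRel → SigRel
  FHas a b S t T = ∃ λ t' → InWindow a b t t' × S t' T
  FHas a b S t F = ∀ t' → InWindow a b t t' → S t' F
  FHas a b S t U = ¬ (FHas a b S t T) × ¬ (FHas a b S t F)

  negS : SigRel → SigRel
  negS S t v = S t (neg v)

  GHas : R → R → SigRel → SigRel
  GHas a b S = negS (FHas a b (negS S))

  Mask : Set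
  Mask = List Interval

  IsMask : Mask → Set
  IsMask m =
    All (λ I → ∀ t → t ∈ᴵ I → 0# ≤ t) m ×
    AllPairs (λ I J → ∀ t → t ∈ᴵ I → ¬ (t ∈ᴵ J)) m

  MaskSet : Set₁
  MaskSet = R → Set

  ⟪_⟫ : Mask → MaskSet
  ⟪ m ⟫ t = Any (t ∈ᴵ_) m

  Past : R → R → Mask → MaskSet
  Past a b m t = Any (λ I → ∃ λ x → x ∈ᴵ I × InWindow a b x t) m

  restrict : SigRel → MaskSet → SigRel
  restrict S M t v = (M t × S t v) ⊎ (¬ (M t) × v ≡ U)

  Context : Set₁
  Context = SigRel → SigRel

  Sufficient : Context → MaskSet → MaskSet → Set
  Sufficient C M' N =
    ∀ (s : Signal) → PiecewiseConstant s →
    ∀ t → 0# ≤ t → ∀ v →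
      restrict (C ⟦ s ⟧) N t v ⇔ restrict (C (restrict ⟦ s ⟧ M')) N t v

  Optimal : Context → MaskSet → MaskSet → Set
  Optimal C M' N =
    Sufficient C M' N ×
    (∀ (m'' : Mask) → IsMask m'' → Sufficient C ⟪ m'' ⟫ N →
       ∀ t → 0# ≤ t → M' t → ⟪ m'' ⟫ t)

module Submission where

open import Defs
open import Data.Product using (_×_; _,_; ∃; proj₁; proj₂)
open import Data.Sum using (inj₁; inj₂)
open import Data.Empty using (⊥-elim)
open import Data.Unit using (tt)
open import Data.Bool using (true)
open import Data.Maybe using (nothing)
open import Data.List using ([]; _∷_)
open import Data.List.Relation.Unary.Any as Any using (here)
open import Data.List.Relation.Unary.Any.Properties using (Any-Σ⁻ʳ)
open import Data.List.Relation.Unary.All using (All; _∷_; []; lookupWith)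
open import Relation.Nullary using (¬_)
open import Relation.Binary.PropositionalEquality using (_≡_; refl)
open import Function.Bundles using (_⇔_; mk⇔; Equivalence)
import Function.Properties.Equivalence as ⇔

-- F_[a,b] and G_[a,b] at time t only look at the window t + [a,b], and
-- P_[a,b] m covers the window of every point of m: so the past mask is
-- sufficient. Conversely, if m'' is sufficient and t' lies in the window
-- of a point x of m, evaluate the context on the constant signal F (for
-- G: T) at x. The value F (resp. T) there is definite, so by sufficiency
-- it must survive masking by m'', which forces m'' to be true at t'.

module _ (ℝ : RealField) where
  open RealField ℝ
  open Semantics ℝ

  AgreeOnWindow : R → R → SigRel → SigRel → R → Set
  AgreeOnWindow a b S S' t = ∀ t' → InWindow a b t t' → ∀ v → S t' v ⇔ S' t' v

  agreeOnWindow-sym : ∀ {a b S S' t} → AgreeOnWindow a b S S' t → AgreeOnWindow a b S' S t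
  agreeOnWindow-sym agree t' w v = ⇔.sym (agree t' w v)

  RespectsWindow : R → R → Context → Set₁
  RespectsWindow a b C = ∀ {S S' t} → AgreeOnWindow a b S S' t → ∀ v → C S t v → C S' t v

  F-T-respectsWindow : ∀ a b {S S' t} → AgreeOnWindow a b S S' t → FHas a b S t T → FHas a b S' t T
  F-T-respectsWindow a b agree (t' , w , p) = t' , w , Equivalence.to (agree t' w T) p

  F-F-respectsWindow : ∀ a b {S S' t} → AgreeOnWindow a b S S' t → FHas a b S t F → FHas a b S' t F
  F-F-respectsWindow a b agree p t' w = Equivalence.to (agree t' w F) (p t' w)

  F-respectsWindow : ∀ a b → RespectsWindow a b (FHas a b)
  F-respectsWindow a b agree T = F-T-respectsWindow a b agree
  F-respectsWindow a b agree F = F-F-respectsWindow a b agree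
  F-respectsWindow a b agree U (¬T , ¬F) =
    (λ p → ¬T (F-T-respectsWindow a b (agreeOnWindow-sym agree) p)) ,
    (λ p → ¬F (F-F-respectsWindow a b (agreeOnWindow-sym agree) p))

  G-respectsWindow : ∀ a b → RespectsWindow a b (GHas a b)
  G-respectsWindow a b agree v = F-respectsWindow a b (λ t' w v' → agree t' w (neg v')) (neg v)

  restrict-inside : ∀ S M {t v} → M t → restrict S M t v → S t v
  restrict-inside S M _  (inj₁ (_ , p))  = p
  restrict-inside S M Mt (inj₂ (¬Mt , _)) = ⊥-elim (¬Mt Mt)

  restrict-defined : ∀ S M {t v} → ¬ (v ≡ U) → restrict S M t v → M t
  restrict-defined S M _   (inj₁ (Mt , _))   = Mt
  restrict-defined S M v≢U (inj₂ (_ , refl)) = ⊥-elim (v≢U refl)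

  restrict-mono : ∀ S S' M {t v} → (M t → S t v → S' t v) → restrict S M t v → restrict S' M t v
  restrict-mono S S' M f (inj₁ (Mt , p)) = inj₁ (Mt , f Mt p)
  restrict-mono S S' M f (inj₂ q) = inj₂ q

  restrict-agreeOnWindow : ∀ {a b t} S M → (∀ t' → InWindow a b t t' → M t') →
                           AgreeOnWindow a b S (restrict S M) t
  restrict-agreeOnWindow S M M⊇window t' w v =
    mk⇔ (λ p → inj₁ (M⊇window t' w , p)) (restrict-inside S M (M⊇window t' w))

  window⊆past : ∀ a b m {t t'} → ⟪ m ⟫ t → InWindow a b t t' → Past a b m t'
  window⊆past a b m {t} t∈m w = Any.map (λ t∈I → t , t∈I , w) t∈m

  past-source : ∀ {a b m t} → All (λ I → ∀ x → x ∈ᴵ I → 0# ≤ x) m → Past a b m t →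
                ∃ λ x → ⟪ m ⟫ x × 0# ≤ x × InWindow a b x t
  past-source {m = m} m≥0 t∈past with x , x∈m×window ← Any-Σ⁻ʳ t∈past =
    x , x∈m , lookupWith (λ I≥0 → I≥0 x) m≥0 x∈m , proj₂ (proj₂ (Any.satisfied x∈m×window))
    where
      x∈m : ⟪ m ⟫ x
      x∈m = Any.map proj₁ x∈m×window

  const-piecewiseConstant : ∀ c → PiecewiseConstant (λ _ → c)
  const-piecewiseConstant c =
    (interval 0# true nothing true ∷ []) , (λ t t≥0 → here (t≥0 , tt)) , ((λ _ _ _ _ → refl) ∷ [])

  past-sufficient : ∀ a b C m → RespectsWindow a b C → Sufficient C (Past a b m) ⟪ m ⟫
  past-sufficient a b C m respects s _ t _ v =
    mk⇔ (restrict-mono (C ⟦ s ⟧) (C masked) ⟪ m ⟫ (λ t∈m → respects (agree t∈m) v))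
        (restrict-mono (C masked) (C ⟦ s ⟧) ⟪ m ⟫ (λ t∈m → respects (agreeOnWindow-sym (agree t∈m)) v))
    where
      masked : SigRel
      masked = restrict ⟦ s ⟧ (Past a b m)

      agree : ⟪ m ⟫ t → AgreeOnWindow a b ⟦ s ⟧ masked t
      agree t∈m = restrict-agreeOnWindow ⟦ s ⟧ (Past a b m) (λ t' → window⊆past a b m t∈m)

  -- Holds definitionally for FHas with v = c = F and for GHas with v = c = T.
  WindowForall : R → R → Context → V3 → V3 → Set₁
  WindowForall a b C v c = ∀ S x → C S x v ⇔ (∀ t' → InWindow a b x t' → S t' c)

  past-optimal : ∀ a b C v c m → IsMask m → ¬ (c ≡ U) → WindowForall a b C v c →
                 ∀ m'' → IsMask m'' → Sufficient C ⟪ m'' ⟫ ⟪ m ⟫ →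
                 ∀ t → 0# ≤ t → Past a b m t → ⟪ m'' ⟫ t
  past-optimal a b C v c m (m≥0 , _) c≢U characterised m'' _ sufficient t _ t∈past
    with x , x∈m , x≥0 , w ← past-source m≥0 t∈past =
    restrict-defined constant ⟪ m'' ⟫ c≢U (Equivalence.to (characterised (restrict constant ⟪ m'' ⟫) x) masked t w)
    where
      constant : SigRel
      constant = ⟦ (λ _ → c) ⟧

      unmasked : C constant x v
      unmasked = Equivalence.from (characterised constant x) (λ _ _ → refl)

      masked : C (restrict constant ⟪ m'' ⟫) x v
      masked = restrict-inside (C (restrict constant ⟪ m'' ⟫)) ⟪ m ⟫ x∈m
        (Equivalence.to (sufficient _ (const-piecewiseConstant c) x x≥0 v) (inj₁ (x∈m , unmasked)))

mainTheorem2 : (ℝ : RealField) →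
  let open RealField ℝ
      open Semantics ℝ
  in (a b : R) → 0# ≤ a → a ≤ b → (m : Mask) → IsMask m →
     (Sufficient (FHas a b) (Past a b m) ⟪ m ⟫ × Optimal (FHas a b) (Past a b m) ⟪ m ⟫) ×
     (Sufficient (GHas a b) (Past a b m) ⟪ m ⟫ × Optimal (GHas a b) (Past a b m) ⟪ m ⟫)
mainTheorem2 ℝ a b _ _ m isMask =
  (F-sufficient , F-sufficient , past-optimal ℝ a b (FHas a b) F F m isMask (λ ()) (λ _ _ → ⇔.refl)) ,
  (G-sufficient , G-sufficient , past-optimal ℝ a b (GHas a b) T T m isMask (λ ()) (λ _ _ → ⇔.refl))
  where
    open Semantics ℝ
    F-sufficient : Sufficient (FHas a b) (Past a b m) ⟪ m ⟫
    F-sufficient = past-sufficient ℝ a b (FHas a b) m (F-respectsWindow ℝ a b)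
    G-sufficient : Sufficient (GHas a b) (Past a b m) ⟪ m ⟫
    G-sufficient = past-sufficient ℝ a b (GHas a b) m (G-respectsWindow ℝ a b)
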